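{- Let $(G,\mathcal{B})$ be a biased graph in which no connected component of $G$ is balanced, and let $H$ be an important balanced subgraph of $G$ of cost at most $k$. Then $H$ has at most $k$ connected components, and for every vertex set $K\subseteq V(H)$ inducing a connected component of $H$, $K$ is an important subset of $(G,\mathcal{B})$ and $N_G(K)\cap V(H)=\emptyset$.
   Context: A biased graph is a pair $(G,\mathcal{B})$, $G$ an undirected graph and $\mathcal{B}$ a set of cycles (balanced) such that in every theta subgraph, if two of its three cycles are balanced then so is the third. A subgraph is balanced if all its cycles are in $\mathcal{B}$. $\delta_G(X)$ is the set of edges with exactly one endpoint in $X$ and $N_G(X)$ the set of vertices outside $X$ adjacent to $X$. The cost of a subgraph $H$ is $|\delta_G(V(H))|+|E(G[V(H)])\setminus E(H)|$. A balanced subgraph $H'$ (strictly) dominates $H$ if $V(H)\subseteq V(H')$ and $\mathrm{cost}(H)\ge\mathrm{cost}(H')$ (at least one strict); $H$ is important if no balanced subgraph strictly dominates it. A cleaning set is an edge set whose removal makes a graph balanced; the cost of $X\subseteq V(G)$ is $|\delta_G(X)|$ plus the minimum size of a cleaning set for $G[X]$; $X$ strictly dominates $Y$ if $X\supseteq Y$, $\mathrm{cost}(X)\le\mathrm{cost}(Y)$ and one of these is strict; $X$ is an important subset if nothing strictly dominates it. -}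

module Defs where

open import Data.Nat using (ℕ; suc; _≤_; _<_; _+_)
open import Data.Fin using (Fin)
open import Data.Fin.Subset using (⊤; Subset; _∈_; _∉_; _⊆_; _⊂_; _∪_; _─_; ∣_∣; Nonempty)
open import Data.Bool using (Bool; _∧_; _xor_)
open import Data.Vec using (tabulate; lookup)
open import Data.List using (List; []; _∷_; _++_)
import Data.List.Membership.Propositional as L
open import Data.List.Relation.Unary.Unique.Propositional using (Unique)
open import Data.Product using (Σ; ∃; ∃-syntax; _×_; _,_; proj₁; proj₂)
open import Data.Sum using (_⊎_)
open import Relation.Binary.PropositionalEquality using (_≡_; _≢_)
open import Relation.Nullary using (¬_)
open import Function.Bundles using (_⇔_)

-- A finite undirected multigraph (loops and parallel edges allowed):
-- vertices Fin n, edges Fin m, each edge has two (unordered) endpoints.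
record Graph : Set where
  field
    n    : ℕ
    m    : ℕ
    ends : Fin m → Fin n × Fin n

module _ (G : Graph) where
  open Graph G

  Vertex : Set
  Vertex = Fin n

  Edge : Set
  Edge = Fin m

  VSet : Set
  VSet = Subset n

  ESet : Set
  ESet = Subset m

  Joins : Edge → Vertex → Vertex → Set
  Joins e u w = ends e ≡ (u , w) ⊎ ends e ≡ (w , u)

  data Walk : Vertex → Vertex → Set where
    here : ∀ {v} → Walk v v
    step : ∀ {u w v} (e : Edge) → Joins e u w → Walk w v → Walk u v

  walkVerts : ∀ {u v} → Walk u v → List Vertex
  walkVerts {u} here = u ∷ []
  walkVerts {u} (step e j p) = u ∷ walkVerts p

  walkEdges : ∀ {u v} → Walk u v → List Edge
  walkEdges here = []
  walkEdges (step e j p) = e ∷ walkEdges p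

  IsPath : ∀ {u v} → Walk u v → Set
  IsPath p = Unique (walkVerts p)

  edgeSetOf : List Edge → ESet → Set
  edgeSetOf es C = ∀ f → (f ∈ C) ⇔ (f L.∈ es)

  -- C is (the edge set of) a cycle of G: an edge e joining u and w closed
  -- up by a path from w to u not using e (loops: trivial path; digons: parallel edge)
  IsCycle : ESet → Set
  IsCycle C =
    Σ Vertex λ u → Σ Vertex λ w → Σ Edge λ e → Σ (Joins e u w) λ _ →
    Σ (Walk w u) λ P → IsPath P × (¬ (e L.∈ walkEdges P)) ×
      (∀ f → (f ∈ C) ⇔ (f ≡ e ⊎ f L.∈ walkEdges P))

  Disjoint2 : ∀ {u v} → Vertex → Vertex → Walk u v → Walk u v → Set
  Disjoint2 u v P Q =
    (∀ f → f L.∈ walkEdges P → ¬ (f L.∈ walkEdges Q)) ×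
    (∀ x → x L.∈ walkVerts P → x L.∈ walkVerts Q → x ≡ u ⊎ x ≡ v)

  -- Bias: a predicate B on edge sets (meaningful on cycles); the theta property
  ThetaProperty : (ESet → Set) → Set
  ThetaProperty B =
    ∀ (u v : Vertex) → u ≢ v → (P₁ P₂ P₃ : Walk u v) →
    IsPath P₁ → IsPath P₂ → IsPath P₃ →
    Disjoint2 u v P₁ P₂ → Disjoint2 u v P₁ P₃ → Disjoint2 u v P₂ P₃ →
    (C₁₂ C₁₃ C₂₃ : ESet) →
    edgeSetOf (walkEdges P₁ ++ walkEdges P₂) C₁₂ →
    edgeSetOf (walkEdges P₁ ++ walkEdges P₃) C₁₃ →
    edgeSetOf (walkEdges P₂ ++ walkEdges P₃) C₂₃ →
    B C₁₂ → B C₁₃ → B C₂₃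

  src tgt : Edge → Vertex
  src e = proj₁ (ends e)
  tgt e = proj₂ (ends e)

  δ : VSet → ESet
  δ X = tabulate λ e → lookup X (src e) xor lookup X (tgt e)

  E[_] : VSet → ESet
  E[ X ] = tabulate λ e → lookup X (src e) ∧ lookup X (tgt e)

  record Subgraph : Set where
    constructor sub
    field
      V  : VSet
      E  : ESet
      wf : E ⊆ E[ V ]
  open Subgraph public

  BalancedE : (ESet → Set) → ESet → Set
  BalancedE B F = ∀ C → IsCycle C → C ⊆ F → B C

  Balanced : (ESet → Set) → Subgraph → Set
  Balanced B H = BalancedE B (E H)

  cost : Subgraph → ℕ
  cost H = ∣ δ (V H) ∣ + ∣ E[ V H ] ─ E H ∣

  StrictlyDominatesSub : (ESet → Set) → Subgraph → Subgraph → Set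
  StrictlyDominatesSub B H' H =
    Balanced B H' × V H ⊆ V H' × cost H' ≤ cost H × (V H ≢ V H' ⊎ cost H' < cost H)

  ImportantSub : (ESet → Set) → Subgraph → Set
  ImportantSub B H = ¬ (Σ Subgraph λ H' → StrictlyDominatesSub B H' H)

  -- F is a cleaning set for G[X]: removing F from G[X] leaves it balanced
  -- (w.l.o.g. F ⊆ E(G[X]); only edges of G[X] matter)
  Cleaning : (ESet → Set) → VSet → ESet → Set
  Cleaning B X F = F ⊆ E[ X ] × BalancedE B (E[ X ] ─ F)

  CostSet : (ESet → Set) → VSet → ℕ → Set
  CostSet B X c =
    (Σ ESet λ F → Cleaning B X F × c ≡ ∣ δ X ∣ + ∣ F ∣) ×
    (∀ F → Cleaning B X F → c ≤ ∣ δ X ∣ + ∣ F ∣)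

  StrictlyDominatesSet : (ESet → Set) → VSet → VSet → Set
  StrictlyDominatesSet B X Y =
    Y ⊆ X × Σ ℕ λ cx → Σ ℕ λ cy →
      CostSet B X cx × CostSet B Y cy × cx ≤ cy × (Y ≢ X ⊎ cx < cy)

  ImportantSet : (ESet → Set) → VSet → Set
  ImportantSet B Y = ¬ (Σ VSet λ X → StrictlyDominatesSet B X Y)

  IsComponentOf : VSet → ESet → VSet → Set
  IsComponentOf W F K =
    K ⊆ W × Nonempty K ×
    (∀ x y → x ∈ K → y ∈ K →
       Σ (Walk x y) λ p → ∀ f → f L.∈ walkEdges p → f ∈ F) ×
    (∀ e → e ∈ F → (src e ∈ K ⇔ tgt e ∈ K))

  InNbhd : VSet → Vertex → Set
  InNbhd K v = v ∉ K × Σ Edge λ e → Σ Vertex λ u → Joins e u v × u ∈ K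

module Submission where

-- Let K be a component of H. An edge of G from K to a vertex of V(H) − K is not in E(H); adding it to H
-- keeps H balanced, since no cycle crosses the cut around K exactly once, and lowers the cost by one.
-- Hence N(K) ∩ V(H) = ∅. So every component of H contains an endpoint of an edge counted by cost(H)
-- (otherwise it would be a balanced component of G), and components sharing such an edge are equal:
-- H has at most cost(H) ≤ k components.
-- Now let X, with an optimal cleaning set F, strictly dominate K. Replacing H inside X by G[X] − F gives
-- H′ = (V(H) ∪ X, (E(H) ∩ E(G − X)) ∪ (E(G[X]) − F)), balanced because each of its cycles lies inside X or
-- outside it. Counting edge by edge, cost(H′) + |δ(K)| + |E(G[K]) − E(H)| ≤ cost(H) + cost(X), and
-- E(G[K]) − E(H) cleans K, so cost(H′) ≤ cost(H) + cost(X) − cost(K) and H′ dominates H. The domination is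
-- strict unless X ⊆ V(H) and cost(X) = cost(K). Then δ(K) ⊆ δ(X) and F ∩ E(G[K]) cleans K, so equality
-- forces δ(X) ⊆ δ(K) and F ⊆ E(G[K]), which makes X − K a nonempty union of balanced components of G.

open import Defs
open import Data.Nat using (ℕ; zero; suc; _+_; _≤_; _<_; _≤ᵇ_; z≤n; s≤s)
open import Data.Nat.Properties
  using (+-0-commutativeMonoid; +-mono-≤; +-monoʳ-≤; +-monoʳ-<; +-mono-<-≤; +-mono-≤-<; +-suc; +-cancelʳ-≤;
         +-cancelʳ-<; ≤ᵇ⇒≤; ≤-trans; ≤-reflexive; ≤-<-trans; <-≤-trans; <⇒≤; <-irrefl; module ≤-Reasoning)
open import Data.Nat.Induction using (<-wellFounded)
open import Data.Bool using (Bool; true; false; not; _∧_; _∨_; _xor_; T)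
open import Data.Bool.Properties using (_≟_; T-∧; T-≡; ∧-zeroʳ; ∧-identityʳ)
import Data.Fin as Fin
open Fin using (Fin)
open import Data.Fin.Properties using (any?) renaming (_≟_ to _≟ᶠ_)
open import Data.Fin.Subset using (Subset; ⊤; ⁅_⁆; _∈_; _∉_; _⊆_; _⊂_; _∪_; _∩_; _─_; _-_; ∁; ∣_∣)
open import Data.Fin.Subset.Properties
  using (_∈?_; ∈⊤; nonempty?; x∈⁅x⁆; x∈⁅y⁆⇒x≡y; x∈p∪q⁻; x∈p∩q⁺; x∈p∩q⁻; x∈∁p⇒x∉p; x∈p∧x∉q⇒x∈p─q;
         x∈p∧x≢y⇒x∈p-y; p⊆p∪q; q⊆p∪q; p∩q⊆p; p∩q⊆q; p─q⊆p; p─q─r≡p─q∪r; ⊆-refl; ⊆-antisym;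
         ∣p∣≤∣x∷p∣; ∣p∩q∣≤∣p∣; p⊆q⇒∣p∣≤∣q∣; p⊂q⇒∣p∣<∣q∣; p⊂q⇒∁p⊃∁q; x∈p⇒∣p-x∣<∣p∣)
open import Data.Vec using ([]; _∷_; lookup)
open import Data.Vec.Properties using (lookup∘tabulate; lookup-zipWith; lookup-map; []=⇒lookup; lookup⇒[]=)
open import Data.List using (List; []; _∷_; length)
open import Data.List.Membership.Propositional using () renaming (_∈_ to _∈ₗ_; _∉_ to _∉ₗ_)
open import Data.List.Relation.Unary.Any using (here; there)
open import Data.List.Relation.Unary.All as All using (All; []; _∷_)
open import Data.List.Relation.Unary.AllPairs using ([]; _∷_)
open import Data.List.Relation.Unary.Unique.Propositional using (Unique)
open import Data.Product using (Σ; ∃; _×_; _,_; proj₁; proj₂)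
open import Data.Sum using (_⊎_; inj₁; inj₂)
open import Data.Empty using (⊥; ⊥-elim)
open import Function using (_∘_)
open import Function.Bundles using (_⇔_; mk⇔; Equivalence)
open import Induction.WellFounded using (Acc; acc)
open import Relation.Binary.PropositionalEquality using (_≡_; _≢_; refl; sym; trans; cong; cong₂; subst)
open import Relation.Nullary using (¬_; yes; no)
open import Relation.Nullary.Decidable using (decidable-stable; _×-dec_; _⊎-dec_; ¬?)
open import Algebra.Properties.CommutativeMonoid.Sum +-0-commutativeMonoid using (sum-syntax; ∑-distrib-+; sum-cong-≗)

open Equivalence using (to; from)

_⇒_ : Bool → Bool → Bool
a ⇒ b = not a ∨ b

infixr 4 _⇒_

_·_ : ∀ {a b} → T (a ⇒ b) → T a → T b
_·_ {true} t _ = t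

infixl 4 _·_

⇒-intro : ∀ {a b} → (T a → T b) → T (a ⇒ b)
⇒-intro {true}  f = f _
⇒-intro {false} f = _

BoolFun : ℕ → Set
BoolFun zero    = Bool
BoolFun (suc n) = Bool → BoolFun n

Tautology : ∀ n → BoolFun n → Set
Tautology zero    b = T b
Tautology (suc n) φ = ∀ b → Tautology n (φ b)

checkAll : ∀ n → BoolFun n → Bool
checkAll zero    b = b
checkAll (suc n) φ = checkAll n (φ true) ∧ checkAll n (φ false)

checkAll-sound : ∀ n (φ : BoolFun n) → T (checkAll n φ) → Tautology n φ
checkAll-sound zero    b t       = t
checkAll-sound (suc n) φ t true  = checkAll-sound n (φ true)  (proj₁ (T-∧ .to t))
checkAll-sound (suc n) φ t false = checkAll-sound n (φ false) (proj₂ (T-∧ .to t))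

xor≡true⇔≢ : ∀ {a b} → a xor b ≡ true ⇔ a ≢ b
xor≡true⇔≢ {true}  {true}  = mk⇔ (λ ()) (λ t≢t → ⊥-elim (t≢t refl))
xor≡true⇔≢ {true}  {false} = mk⇔ (λ _ ()) (λ _ → refl)
xor≡true⇔≢ {false} {true}  = mk⇔ (λ _ ()) (λ _ → refl)
xor≡true⇔≢ {false} {false} = mk⇔ (λ ()) (λ f≢f → ⊥-elim (f≢f refl))

T-not⇒¬T : ∀ {b} → T (not b) → ¬ T b
T-not⇒¬T {false} _ ()

T⇔T⇒≡ : ∀ {a b} → (T a ⇔ T b) → a ≡ b
T⇔T⇒≡ {true}  {true}  _   = refl
T⇔T⇒≡ {false} {false} _   = refl
T⇔T⇒≡ {true}  {false} a⇔b = ⊥-elim (a⇔b .to _)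
T⇔T⇒≡ {false} {true}  a⇔b = ⊥-elim (a⇔b .from _)

𝟙 : Bool → ℕ
𝟙 true  = 1
𝟙 false = 0

edgeCost : Bool → Bool → Bool → ℕ
edgeCost s t e = 𝟙 (s xor t) + 𝟙 ((s ∧ t) ∧ not e)

-- One edge's share of graft-cost below: ks, kt, xs, xt, vs, vt record whether its endpoints lie in K, X
-- and V(H), and h, f whether it lies in E(H) and F. The argument T (checkAll 8 φ) is left to normalisation,
-- which evaluates φ at all 2⁸ assignments.
uncrossing-at-edge : ∀ ks kt xs xt vs vt h f →
  T (ks ⇒ xs) → T (kt ⇒ xt) → T (ks ⇒ vs) → T (kt ⇒ vt) → T (ks ∧ vt ⇒ kt) → T (kt ∧ vs ⇒ ks) →
  edgeCost (vs ∨ xs) (vt ∨ xt) ((h ∧ (not xs ∧ not xt)) ∨ ((xs ∧ xt) ∧ not f)) + edgeCost ks kt h ≤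
  edgeCost vs vt h + (𝟙 (xs xor xt) + 𝟙 f)
uncrossing-at-edge ks kt xs xt vs vt h f k⊆x₁ k⊆x₂ k⊆v₁ k⊆v₂ closed₁ closed₂ =
  ≤ᵇ⇒≤ _ _ (checkAll-sound 8 φ _ ks kt xs xt vs vt h f · k⊆x₁ · k⊆x₂ · k⊆v₁ · k⊆v₂ · closed₁ · closed₂)
  where
  φ : BoolFun 8
  φ ks kt xs xt vs vt h f =
    (ks ⇒ xs) ⇒ (kt ⇒ xt) ⇒ (ks ⇒ vs) ⇒ (kt ⇒ vt) ⇒ (ks ∧ vt ⇒ kt) ⇒ (kt ∧ vs ⇒ ks) ⇒
    (edgeCost (vs ∨ xs) (vt ∨ xt) ((h ∧ (not xs ∧ not xt)) ∨ ((xs ∧ xt) ∧ not f)) + edgeCost ks kt h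
      ≤ᵇ edgeCost vs vt h + (𝟙 (xs xor xt) + 𝟙 f))

-- Finite subsets

module _ {n : ℕ} where

  ∈⇔T : ∀ {x} {p : Subset n} → x ∈ p ⇔ T (lookup p x)
  ∈⇔T {x} {p} = mk⇔ (λ x∈p → T-≡ .from ([]=⇒lookup x∈p)) (λ t → lookup⇒[]= x p (T-≡ .to t))

  lookup-∪ : ∀ (p q : Subset n) i → lookup (p ∪ q) i ≡ lookup p i ∨ lookup q i
  lookup-∪ p q i = lookup-zipWith _∨_ i p q

  lookup-∩ : ∀ (p q : Subset n) i → lookup (p ∩ q) i ≡ lookup p i ∧ lookup q i
  lookup-∩ p q i = lookup-zipWith _∧_ i p q

  lookup-∁ : ∀ (p : Subset n) i → lookup (∁ p) i ≡ not (lookup p i)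
  lookup-∁ p i = lookup-map i not p

  lookup≡⇔ : ∀ {p : Subset n} {x y} → lookup p x ≡ lookup p y ⇔ (x ∈ p ⇔ y ∈ p)
  lookup≡⇔ {p} {x} {y} = mk⇔
    (λ eq → mk⇔ (λ x∈p → lookup⇒[]= y p (trans (sym eq) ([]=⇒lookup x∈p)))
                (λ y∈p → lookup⇒[]= x p (trans eq ([]=⇒lookup y∈p))))
    (λ x⇔y → T⇔T⇒≡ (mk⇔ (∈⇔T .to ∘ x⇔y .to ∘ ∈⇔T .from) (∈⇔T .to ∘ x⇔y .from ∘ ∈⇔T .from)))

  lookup≡false⇒∉ : ∀ {p : Subset n} {x} → lookup p x ≡ false → x ∉ p
  lookup≡false⇒∉ eq x∈p with trans (sym eq) ([]=⇒lookup x∈p)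
  ... | ()

  ∈∈⇒lookup≡ : ∀ {p : Subset n} {x y} → x ∈ p → y ∈ p → lookup p x ≡ lookup p y
  ∈∈⇒lookup≡ x∈p y∈p = lookup≡⇔ .from (mk⇔ (λ _ → y∈p) (λ _ → x∈p))

  ∉∉⇒lookup≡ : ∀ {p : Subset n} {x y} → x ∉ p → y ∉ p → lookup p x ≡ lookup p y
  ∉∉⇒lookup≡ x∉p y∉p = lookup≡⇔ .from (mk⇔ (⊥-elim ∘ x∉p) (⊥-elim ∘ y∉p))

  ⊆⇒lookup⇒ : ∀ {p q : Subset n} → p ⊆ q → ∀ i → T (lookup p i ⇒ lookup q i)
  ⊆⇒lookup⇒ p⊆q i = ⇒-intro (∈⇔T .to ∘ p⊆q ∘ ∈⇔T .from)

  ⊆-or-witness : ∀ (p q : Subset n) → p ⊆ q ⊎ ∃ λ x → x ∈ p × x ∉ q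
  ⊆-or-witness p q with any? (λ x → x ∈? p ×-dec ¬? (x ∈? q))
  ... | yes (x , x∈p , x∉q) = inj₂ (x , x∈p , x∉q)
  ... | no ∄x = inj₁ λ {x} x∈p → decidable-stable (x ∈? q) λ x∉q → ∄x (x , x∈p , x∉q)

lookup-─ : ∀ {n} (p q : Subset n) i → lookup (p ─ q) i ≡ lookup p i ∧ not (lookup q i)
lookup-─ (x ∷ p) (true  ∷ q) Fin.zero = sym (∧-zeroʳ x)
lookup-─ (x ∷ p) (false ∷ q) Fin.zero = sym (∧-identityʳ x)
lookup-─ (x ∷ p) (y ∷ q) (Fin.suc i)  = lookup-─ p q i

x∈p─q⇒x∉q : ∀ {n} {x : Fin n} (p q : Subset n) → x ∈ p ─ q → x ∉ q
x∈p─q⇒x∉q {x = x} p q x∈p─q x∈q =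
  T-not⇒¬T (proj₂ (T-∧ .to (subst T (lookup-─ p q x) (∈⇔T .to x∈p─q)))) (∈⇔T .to x∈q)

p─[p─q]⊆q : ∀ {n} (p q : Subset n) → p ─ (p ─ q) ⊆ q
p─[p─q]⊆q p q {x} x∈ = decidable-stable (x ∈? q) λ x∉q →
  x∈p─q⇒x∉q p (p ─ q) x∈ (x∈p∧x∉q⇒x∈p─q (p─q⊆p p (p ─ q) x∈) x∉q)

∈∪⁅⁆⇒∈ : ∀ {n} {p : Subset n} {x y} → x ∈ p ∪ ⁅ y ⁆ → x ≢ y → x ∈ p
∈∪⁅⁆⇒∈ {p = p} {x} {y} x∈ x≢y with x∈p∪q⁻ p ⁅ y ⁆ x∈
... | inj₁ x∈p = x∈p
... | inj₂ x∈y = ⊥-elim (x≢y (x∈⁅y⁆⇒x≡y y x∈y))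

∣p∪q∣≤∣p∣+∣q∣ : ∀ {n} (p q : Subset n) → ∣ p ∪ q ∣ ≤ ∣ p ∣ + ∣ q ∣
∣p∪q∣≤∣p∣+∣q∣ []          []          = z≤n
∣p∪q∣≤∣p∣+∣q∣ (true  ∷ p) (y     ∷ q) = s≤s (≤-trans (∣p∪q∣≤∣p∣+∣q∣ p q) (+-monoʳ-≤ ∣ p ∣ (∣p∣≤∣x∷p∣ y q)))
∣p∪q∣≤∣p∣+∣q∣ (false ∷ p) (true  ∷ q) = ≤-trans (s≤s (∣p∪q∣≤∣p∣+∣q∣ p q)) (≤-reflexive (sym (+-suc ∣ p ∣ ∣ q ∣)))
∣p∪q∣≤∣p∣+∣q∣ (false ∷ p) (false ∷ q) = ∣p∪q∣≤∣p∣+∣q∣ p q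

∣p∣≡∑ : ∀ {n} (p : Subset n) → ∣ p ∣ ≡ ∑[ i < n ] 𝟙 (lookup p i)
∣p∣≡∑ []          = refl
∣p∣≡∑ (true  ∷ p) = cong suc (∣p∣≡∑ p)
∣p∣≡∑ (false ∷ p) = ∣p∣≡∑ p

∑-mono-≤ : ∀ {n} {f g : Fin n → ℕ} → (∀ i → f i ≤ g i) → ∑[ i < n ] f i ≤ ∑[ i < n ] g i
∑-mono-≤ {zero}  f≤g = z≤n
∑-mono-≤ {suc n} f≤g = +-mono-≤ (f≤g Fin.zero) (∑-mono-≤ (λ i → f≤g (Fin.suc i)))

module _ {A : Set} {n : ℕ} (R : A → Fin n → Set) (R-injective : ∀ {x y i} → R x i → R y i → x ≡ y) where

  length≤∣p∣ : ∀ (p : Subset n) {xs} → Unique xs → All (λ x → ∃ λ i → i ∈ p × R x i) xs → length xs ≤ ∣ p ∣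
  length≤∣p∣ p []               []                         = z≤n
  length≤∣p∣ p {x ∷ _} (x∉xs ∷ unique) ((i , i∈p , Rxi) ∷ witnesses) =
    ≤-trans (s≤s (length≤∣p∣ (p - i) unique (All.zipWith avoid-i (x∉xs , witnesses)))) (x∈p⇒∣p-x∣<∣p∣ i∈p)
    where
    avoid-i : ∀ {y} → x ≢ y × (∃ λ j → j ∈ p × R y j) → ∃ λ j → j ∈ p - i × R y j
    avoid-i (x≢y , j , j∈p , Ryj) = j , x∈p∧x≢y⇒x∈p-y j∈p (λ { refl → x≢y (R-injective Rxi Ryj) }) , Ryj

module _ (G : Graph) where

  Monochromatic : {A : Set} → (Vertex G → A) → Edge G → Set
  Monochromatic p e = p (src G e) ≡ p (tgt G e)

  Joins-ends : ∀ {e u w} → Joins G e u w → (src G e ≡ u × tgt G e ≡ w) ⊎ (src G e ≡ w × tgt G e ≡ u)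
  Joins-ends (inj₁ ends≡) = inj₁ (cong proj₁ ends≡ , cong proj₂ ends≡)
  Joins-ends (inj₂ ends≡) = inj₂ (cong proj₁ ends≡ , cong proj₂ ends≡)

  Joins-sym : ∀ {e u w} → Joins G e u w → Joins G e w u
  Joins-sym (inj₁ ends≡) = inj₂ ends≡
  Joins-sym (inj₂ ends≡) = inj₁ ends≡

  monochromatic⇔ : ∀ {A : Set} (p : Vertex G → A) {e u w} → Joins G e u w → Monochromatic p e ⇔ (p u ≡ p w)
  monochromatic⇔ p j with Joins-ends j
  ... | inj₁ (refl , refl) = mk⇔ (λ eq → eq) (λ eq → eq)
  ... | inj₂ (refl , refl) = mk⇔ sym sym

  lookup-δ : ∀ X e → lookup (δ G X) e ≡ lookup X (src G e) xor lookup X (tgt G e)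
  lookup-δ X = lookup∘tabulate _

  lookup-E[] : ∀ X e → lookup (E[_] G X) e ≡ lookup X (src G e) ∧ lookup X (tgt G e)
  lookup-E[] X = lookup∘tabulate _

  ∈δ⇔ : ∀ {X e} → e ∈ δ G X ⇔ (¬ Monochromatic (lookup X) e)
  ∈δ⇔ {X} {e} = mk⇔ (λ e∈δ → xor≡true⇔≢ .to (trans (sym (lookup-δ X e)) ([]=⇒lookup e∈δ)))
                     (λ s≢t → lookup⇒[]= e (δ G X) (trans (lookup-δ X e) (xor≡true⇔≢ .from s≢t)))

  ∉δ⇒monochromatic : ∀ {X e} → e ∉ δ G X → Monochromatic (lookup X) e
  ∉δ⇒monochromatic {X} {e} e∉δ = decidable-stable (lookup X (src G e) ≟ lookup X (tgt G e)) (λ s≢t → e∉δ (∈δ⇔ {X} .from s≢t))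

  ¬monochromatic-across : ∀ {X e u w} → Joins G e u w → u ∈ X → w ∉ X → ¬ Monochromatic (lookup X) e
  ¬monochromatic-across {X} j u∈X w∉X mono = w∉X (lookup≡⇔ .to (monochromatic⇔ (lookup X) j .to mono) .to u∈X)

  ∈δ⁺ : ∀ {X e u w} → Joins G e u w → u ∈ X → w ∉ X → e ∈ δ G X
  ∈δ⁺ {X} j u∈X w∉X = ∈δ⇔ {X} .from (¬monochromatic-across j u∈X w∉X)

  ∈δ⁻ : ∀ {X e} → e ∈ δ G X → ∃ λ u → ∃ λ w → Joins G e u w × u ∈ X × w ∉ X
  ∈δ⁻ {X} {e} e∈δ with src G e ∈? X
  ... | yes s∈X = src G e , tgt G e , inj₁ refl , s∈X , λ t∈X → ∈δ⇔ {X} .to e∈δ (∈∈⇒lookup≡ s∈X t∈X)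
  ... | no  s∉X = tgt G e , src G e , inj₂ refl , t∈X , s∉X
    where
    t∈X : tgt G e ∈ X
    t∈X = decidable-stable (tgt G e ∈? X) λ t∉X → ∈δ⇔ {X} .to e∈δ (∉∉⇒lookup≡ s∉X t∉X)

  ∈E[]⇔ : ∀ {X e} → e ∈ E[_] G X ⇔ (src G e ∈ X × tgt G e ∈ X)
  ∈E[]⇔ {X} {e} = mk⇔
    (λ e∈E → let (s , t) = T-∧ .to (subst T (lookup-E[] X e) (∈⇔T .to e∈E)) in ∈⇔T .from s , ∈⇔T .from t)
    (λ (s∈X , t∈X) → ∈⇔T .from (subst T (sym (lookup-E[] X e)) (T-∧ .from (∈⇔T .to s∈X , ∈⇔T .to t∈X))))

  ∈E[]⁺ : ∀ {X e u w} → Joins G e u w → u ∈ X → w ∈ X → e ∈ E[_] G X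
  ∈E[]⁺ {X} j u∈X w∈X with Joins-ends j
  ... | inj₁ (refl , refl) = ∈E[]⇔ {X} .from (u∈X , w∈X)
  ... | inj₂ (refl , refl) = ∈E[]⇔ {X} .from (w∈X , u∈X)

  E[]-mono : ∀ {X Y} → X ⊆ Y → E[_] G X ⊆ E[_] G Y
  E[]-mono {X} {Y} X⊆Y e∈E = let (s , t) = ∈E[]⇔ {X} .to e∈E in ∈E[]⇔ {Y} .from (X⊆Y s , X⊆Y t)

  -- Walks, paths and cycles

  _++ʷ_ : ∀ {x y z} → Walk G x y → Walk G y z → Walk G x z
  here       ++ʷ r = r
  step e j q ++ʷ r = step e j (q ++ʷ r)

  reverseʷ : ∀ {x y} → Walk G x y → Walk G y x
  reverseʷ here                    = here
  reverseʷ (step e (inj₁ ends≡) q) = reverseʷ q ++ʷ step e (inj₂ ends≡) here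
  reverseʷ (step e (inj₂ ends≡) q) = reverseʷ q ++ʷ step e (inj₁ ends≡) here

  start∈walkVerts : ∀ {x y} (q : Walk G x y) → x ∈ₗ walkVerts G q
  start∈walkVerts here         = here refl
  start∈walkVerts (step e j q) = here refl

  end∈walkVerts : ∀ {x y} (q : Walk G x y) → y ∈ₗ walkVerts G q
  end∈walkVerts here         = here refl
  end∈walkVerts (step e j q) = there (end∈walkVerts q)

  ends∈walkVerts : ∀ {x y f} (q : Walk G x y) → f ∈ₗ walkEdges G q →
                   src G f ∈ₗ walkVerts G q × tgt G f ∈ₗ walkVerts G q
  ends∈walkVerts (step e j q) (here refl) with Joins-ends j
  ... | inj₁ (refl , refl) = here refl , there (start∈walkVerts q)
  ... | inj₂ (refl , refl) = there (start∈walkVerts q) , here refl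
  ends∈walkVerts (step e j q) (there f∈q) =
    let (s , t) = ends∈walkVerts q f∈q in there s , there t

  module _ {A : Set} (p : Vertex G → A) where

    walk-invariant : ∀ {x y} (q : Walk G x y) → (∀ f → f ∈ₗ walkEdges G q → Monochromatic p f) → p x ≡ p y
    walk-invariant here         mono = refl
    walk-invariant (step e j q) mono =
      trans (monochromatic⇔ p j .to (mono e (here refl))) (walk-invariant q (λ f → mono f ∘ there))

    walkVerts-invariant : ∀ {x y z} (q : Walk G x y) → (∀ f → f ∈ₗ walkEdges G q → Monochromatic p f) →
                          z ∈ₗ walkVerts G q → p z ≡ p x
    walkVerts-invariant here         mono (here refl) = refl
    walkVerts-invariant (step e j q) mono (here refl) = refl
    walkVerts-invariant (step e j q) mono (there z∈q) =
      trans (walkVerts-invariant q (λ f → mono f ∘ there) z∈q) (sym (monochromatic⇔ p j .to (mono e (here refl))))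

  path-head∉tail : ∀ {x w y e} (j : Joins G e x w) (q : Walk G w y) → IsPath G (step e j q) → e ∉ₗ walkEdges G q
  path-head∉tail j q (x∉q ∷ _) e∈q with Joins-ends j | ends∈walkVerts q e∈q
  ... | inj₁ (refl , refl) | (s∈q , _) = All.lookup x∉q s∈q refl
  ... | inj₂ (refl , refl) | (_ , t∈q) = All.lookup x∉q t∈q refl

  path-crossing-once : ∀ {A : Set} (p : Vertex G → A) {e x y} (q : Walk G x y) → IsPath G q → e ∈ₗ walkEdges G q →
    ¬ Monochromatic p e → (∀ f → f ∈ₗ walkEdges G q → f ≢ e → Monochromatic p f) → p x ≢ p y
  path-crossing-once p (step e j q) path (here refl) crossing mono px≡py =
    crossing (monochromatic⇔ p j .from (trans px≡py (sym (walk-invariant p q rest-mono))))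
    where
    rest-mono : ∀ f → f ∈ₗ walkEdges G q → Monochromatic p f
    rest-mono f f∈q = mono f (there f∈q) λ { refl → path-head∉tail j q path f∈q }
  path-crossing-once p {e} (step f j q) path@(_ ∷ rest-path) (there e∈q) crossing mono px≡py with f ≟ᶠ e
  ... | yes refl = path-head∉tail j q path e∈q
  ... | no  f≢e  = path-crossing-once p q rest-path e∈q crossing (λ g → mono g ∘ there)
                     (trans (sym (monochromatic⇔ p j .to (mono f (here refl) f≢e))) px≡py)

  module _ {A : Set} (p : Vertex G → A) {C : ESet G} where

    cycle-crossing-once : IsCycle G C → ∀ {e} → e ∈ C → ¬ Monochromatic p e →
                          (∀ f → f ∈ C → f ≢ e → Monochromatic p f) → ⊥
    cycle-crossing-once (u , w , e₀ , j₀ , P , path , e₀∉P , C⇔) {e} e∈C crossing mono with e₀ ≟ᶠ e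
    ... | yes refl = crossing (monochromatic⇔ p j₀ .from (sym (walk-invariant p P P-mono)))
      where
      P-mono : ∀ f → f ∈ₗ walkEdges G P → Monochromatic p f
      P-mono f f∈P = mono f (C⇔ f .from (inj₂ f∈P)) λ { refl → e₀∉P f∈P }
    ... | no e₀≢e with C⇔ e .to e∈C
    ...   | inj₁ e≡e₀ = e₀≢e (sym e≡e₀)
    ...   | inj₂ e∈P  = path-crossing-once p P path e∈P crossing (λ f f∈P → mono f (C⇔ f .from (inj₂ f∈P)))
                          (sym (monochromatic⇔ p j₀ .to (mono e₀ (C⇔ e₀ .from (inj₁ refl)) e₀≢e)))

    cycle-monochromatic : IsCycle G C → (∀ f → f ∈ C → Monochromatic p f) → ∃ λ a → ∀ f → f ∈ C → p (src G f) ≡ a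
    cycle-monochromatic (u , w , e₀ , j₀ , P , _ , _ , C⇔) mono =
      p w , λ f f∈C → walkVerts-invariant p P (λ g g∈P → mono g (C⇔ g .from (inj₂ g∈P))) (src-on-P f (C⇔ f .to f∈C))
      where
      src-on-P : ∀ f → f ≡ e₀ ⊎ f ∈ₗ walkEdges G P → src G f ∈ₗ walkVerts G P
      src-on-P f (inj₂ f∈P) = proj₁ (ends∈walkVerts P f∈P)
      src-on-P f (inj₁ refl) with Joins-ends j₀
      ... | inj₁ (s≡u , _) = subst (_∈ₗ walkVerts G P) (sym s≡u) (end∈walkVerts P)
      ... | inj₂ (s≡w , _) = subst (_∈ₗ walkVerts G P) (sym s≡w) (start∈walkVerts P)

  -- Components

  component-closed : ∀ {W F K e} → IsComponentOf G W F K → e ∈ F → Monochromatic (lookup K) e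
  component-closed (_ , _ , _ , closed) e∈F = lookup≡⇔ .from (closed _ e∈F)

  component-⊆ : ∀ {W F K Y x} → IsComponentOf G W F K → x ∈ K →
                (∀ e → e ∈ F → Monochromatic (lookup Y) e) → x ∈ Y → K ⊆ Y
  component-⊆ {Y = Y} {x} (_ , _ , connected , _) x∈K Y-closed x∈Y {y} y∈K =
    let (q , q⊆F) = connected x y x∈K y∈K
    in lookup≡⇔ .to (walk-invariant (lookup Y) q (λ f → Y-closed f ∘ q⊆F f)) .to x∈Y

  components-equal : ∀ {W F K₁ K₂ x} → IsComponentOf G W F K₁ → IsComponentOf G W F K₂ → x ∈ K₁ → x ∈ K₂ → K₁ ≡ K₂
  components-equal K₁-comp K₂-comp x∈K₁ x∈K₂ =
    ⊆-antisym (component-⊆ K₁-comp x∈K₁ (λ e → component-closed K₂-comp) x∈K₂)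
              (component-⊆ K₂-comp x∈K₂ (λ e → component-closed K₁-comp) x∈K₁)

  component-of : ∀ a → ∃ λ C → a ∈ C × IsComponentOf G ⊤ ⊤ C
  component-of a = grow ⁅ a ⁆ (<-wellFounded _) (x∈⁅x⁆ a) (λ x∈⁅a⁆ → subst (Walk G a) (sym (x∈⁅y⁆⇒x≡y a x∈⁅a⁆)) here)
    where
    grow : ∀ S → Acc _<_ ∣ ∁ S ∣ → a ∈ S → (∀ {x} → x ∈ S → Walk G a x) → ∃ λ C → a ∈ C × IsComponentOf G ⊤ ⊤ C
    grow S (acc smaller) a∈S reach with nonempty? (δ G S)
    ... | no ∄crossing = S , a∈S , (λ _ → ∈⊤) , (a , a∈S) , walks , closed
      where
      walks : ∀ x y → x ∈ S → y ∈ S → Σ (Walk G x y) λ q → ∀ f → f ∈ₗ walkEdges G q → f ∈ ⊤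
      walks x y x∈S y∈S = reverseʷ (reach x∈S) ++ʷ reach y∈S , λ _ _ → ∈⊤
      closed : ∀ e → e ∈ ⊤ → (src G e ∈ S ⇔ tgt G e ∈ S)
      closed e _ = lookup≡⇔ .to (∉δ⇒monochromatic {S} λ e∈δ → ∄crossing (e , e∈δ))
    ... | yes (e , e∈δ) = extend (∈δ⁻ e∈δ)
      where
      extend : (∃ λ u → ∃ λ w → Joins G e u w × u ∈ S × w ∉ S) → ∃ λ C → a ∈ C × IsComponentOf G ⊤ ⊤ C
      extend (u , w , j , u∈S , w∉S) =
        grow (S ∪ ⁅ w ⁆) (smaller (p⊂q⇒∣p∣<∣q∣ (p⊂q⇒∁p⊃∁q S⊂S∪w))) (p⊆p∪q ⁅ w ⁆ a∈S) reach′
        where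
        S⊂S∪w : S ⊂ S ∪ ⁅ w ⁆
        S⊂S∪w = p⊆p∪q ⁅ w ⁆ , w , q⊆p∪q S ⁅ w ⁆ (x∈⁅x⁆ w) , w∉S
        reach′ : ∀ {x} → x ∈ S ∪ ⁅ w ⁆ → Walk G a x
        reach′ x∈S∪w with x∈p∪q⁻ S ⁅ w ⁆ x∈S∪w
        ... | inj₁ x∈S = reach x∈S
        ... | inj₂ x∈w = subst (Walk G a) (sym (x∈⁅y⁆⇒x≡y w x∈w)) (reach u∈S ++ʷ step e j here)

  -- Balance and cost

  BalancedE-mono : ∀ {B : ESet G → Set} {F F′} → F ⊆ F′ → BalancedE G B F′ → BalancedE G B F
  BalancedE-mono F⊆F′ balanced C cycle C⊆F = balanced C cycle (F⊆F′ ∘ C⊆F)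

  insertEdge : (H : Subgraph G) (e : Edge G) → e ∈ E[_] G (V H) → Subgraph G
  insertEdge H e e∈E[V] = sub (V H) (E H ∪ ⁅ e ⁆) well-formed
    where
    well-formed : E H ∪ ⁅ e ⁆ ⊆ E[_] G (V H)
    well-formed {f} f∈ with x∈p∪q⁻ (E H) ⁅ e ⁆ f∈
    ... | inj₁ f∈H = wf H f∈H
    ... | inj₂ f∈e = subst (_∈ E[_] G (V H)) (sym (x∈⁅y⁆⇒x≡y e f∈e)) e∈E[V]

  insertEdge-cost : ∀ H e (e∈E[V] : e ∈ E[_] G (V H)) → e ∉ E H → cost G (insertEdge H e e∈E[V]) < cost G H
  insertEdge-cost H e e∈E[V] e∉H =
    +-monoʳ-< ∣ δ G (V H) ∣ (subst (λ s → ∣ s ∣ < ∣ E[_] G (V H) ─ E H ∣) (p─q─r≡p─q∪r (E[_] G (V H)) (E H) ⁅ e ⁆)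
                                    (x∈p⇒∣p-x∣<∣p∣ (x∈p∧x∉q⇒x∈p─q e∈E[V] e∉H)))

  costOn : VSet G → ESet G → ℕ
  costOn X F = ∣ δ G X ∣ + ∣ E[_] G X ─ F ∣

  edgeCostAt : VSet G → ESet G → Edge G → ℕ
  edgeCostAt X F e = edgeCost (lookup X (src G e)) (lookup X (tgt G e)) (lookup F e)

  ∣δ∣≡∑ : ∀ X → ∣ δ G X ∣ ≡ ∑[ e < Graph.m G ] 𝟙 (lookup X (src G e) xor lookup X (tgt G e))
  ∣δ∣≡∑ X = trans (∣p∣≡∑ (δ G X)) (sum-cong-≗ (cong 𝟙 ∘ lookup-δ X))

  costOn≡∑ : ∀ X F → costOn X F ≡ ∑[ e < Graph.m G ] edgeCostAt X F e
  costOn≡∑ X F = trans (cong₂ _+_ (∣δ∣≡∑ X) (trans (∣p∣≡∑ (E[_] G X ─ F)) (sum-cong-≗ missing≡)))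
                        (sym (∑-distrib-+ crossing missing))
    where
    crossing missing : Edge G → ℕ
    crossing e = 𝟙 (lookup X (src G e) xor lookup X (tgt G e))
    missing  e = 𝟙 ((lookup X (src G e) ∧ lookup X (tgt G e)) ∧ not (lookup F e))
    missing≡ : ∀ e → 𝟙 (lookup (E[_] G X ─ F) e) ≡ missing e
    missing≡ e = cong 𝟙 (trans (lookup-─ (E[_] G X) F e) (cong (_∧ not (lookup F e)) (lookup-E[] X e)))

NoBalancedComponent : (G : Graph) → (ESet G → Set) → Set
NoBalancedComponent G B = ∀ K → IsComponentOf G ⊤ ⊤ K → ¬ BalancedE G B (E[_] G K)

module ImportantSubgraph (G : Graph) (B : ESet G → Set) (H : Subgraph G)
                         (H-balanced : Balanced G B H) (H-important : ImportantSub G B H) where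

  Component : VSet G → Set
  Component = IsComponentOf G (V H) (E H)

  no-neighbour : ∀ {K} → Component K → ∀ v → v ∈ V H → ¬ InNbhd G K v
  no-neighbour {K} K-comp v v∈V (v∉K , e , u , j , u∈K) with e ∈? E H
  ... | yes e∈H = ¬monochromatic-across G j u∈K v∉K (component-closed G K-comp e∈H)
  ... | no e∉H = H-important (insertEdge G H e e∈E[V] , H+e-balanced , ⊆-refl , <⇒≤ cost< , inj₂ cost<)
    where
    e∈E[V] : e ∈ E[_] G (V H)
    e∈E[V] = ∈E[]⁺ G j (proj₁ K-comp u∈K) v∈V
    cost< : cost G (insertEdge G H e e∈E[V]) < cost G H
    cost< = insertEdge-cost G H e e∈E[V] e∉H
    H+e-balanced : Balanced G B (insertEdge G H e e∈E[V])
    H+e-balanced C cycle C⊆ with e ∈? C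
    ... | no e∉C = H-balanced C cycle λ f∈C → ∈∪⁅⁆⇒∈ (C⊆ f∈C) λ { refl → e∉C f∈C }
    ... | yes e∈C = ⊥-elim (cycle-crossing-once G (lookup K) cycle e∈C (¬monochromatic-across G j u∈K v∉K)
                              λ f f∈C f≢e → component-closed G K-comp (∈∪⁅⁆⇒∈ (C⊆ f∈C) f≢e))

  joined-in-V : ∀ {K e u w} → Component K → Joins G e u w → u ∈ K → w ∈ V H → w ∈ K
  joined-in-V {K} {w = w} K-comp j u∈K w∈V =
    decidable-stable (w ∈? K) λ w∉K → no-neighbour K-comp w w∈V (w∉K , _ , _ , j , u∈K)

  joined-in-Vᵇ : ∀ {K e u w} → Component K → Joins G e u w → T (lookup K u ∧ lookup (V H) w ⇒ lookup K w)
  joined-in-Vᵇ K-comp j = ⇒-intro λ t → let (u∈K , w∈V) = T-∧ .to t in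
    ∈⇔T .to (joined-in-V K-comp j (∈⇔T .from u∈K) (∈⇔T .from w∈V))

  Touches : VSet G → Edge G → Set
  Touches K e = src G e ∈ K ⊎ tgt G e ∈ K

  touching-components-equal : ∀ {K₁ K₂ e} → Component K₁ → Component K₂ → Touches K₁ e → Touches K₂ e → K₁ ≡ K₂
  touching-components-equal c₁ c₂ (inj₁ s∈K₁) (inj₁ s∈K₂) = components-equal G c₁ c₂ s∈K₁ s∈K₂
  touching-components-equal c₁ c₂ (inj₂ t∈K₁) (inj₂ t∈K₂) = components-equal G c₁ c₂ t∈K₁ t∈K₂
  touching-components-equal c₁ c₂ (inj₁ s∈K₁) (inj₂ t∈K₂) =
    components-equal G c₁ c₂ (joined-in-V c₁ (inj₁ refl) s∈K₁ (proj₁ c₂ t∈K₂)) t∈K₂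
  touching-components-equal c₁ c₂ (inj₂ t∈K₁) (inj₁ s∈K₂) =
    components-equal G c₁ c₂ (joined-in-V c₁ (inj₂ refl) t∈K₁ (proj₁ c₂ s∈K₂)) s∈K₂

  costEdges : ESet G
  costEdges = δ G (V H) ∪ (E[_] G (V H) ─ E H)

  component-touches-costEdge : NoBalancedComponent G B → ∀ {K} → Component K → ∃ λ e → e ∈ costEdges × Touches K e
  component-touches-costEdge unbalanced {K} K-comp@(K⊆V , K≠∅ , connected , _)
    with any? (λ e → e ∈? costEdges ×-dec (src G e ∈? K ⊎-dec tgt G e ∈? K))
  ... | yes touching = touching
  ... | no ∄touching = ⊥-elim (unbalanced K K-component-of-G (BalancedE-mono G E[K]⊆H H-balanced))
    where
    stays : ∀ {e u w} → Joins G e u w → u ∈ K → w ∈ K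
    stays {e} {u} {w} j u∈K with w ∈? V H
    ... | yes w∈V = joined-in-V K-comp j u∈K w∈V
    ... | no  w∉V = ⊥-elim (∄touching (e , p⊆p∪q _ (∈δ⁺ G j (K⊆V u∈K) w∉V) , touches))
      where
      touches : Touches K e
      touches with Joins-ends G j
      ... | inj₁ (refl , _) = inj₁ u∈K
      ... | inj₂ (_ , refl) = inj₂ u∈K
    K-component-of-G : IsComponentOf G ⊤ ⊤ K
    K-component-of-G = (λ _ → ∈⊤) , K≠∅ , (λ x y x∈K y∈K → proj₁ (connected x y x∈K y∈K) , λ _ _ → ∈⊤) ,
                       λ e _ → mk⇔ (stays (inj₁ refl)) (stays (inj₂ refl))
    E[K]⊆H : E[_] G K ⊆ E H
    E[K]⊆H {f} f∈E[K] = decidable-stable (f ∈? E H) λ f∉H →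
      ∄touching (f , q⊆p∪q _ _ (x∈p∧x∉q⇒x∈p─q (E[]-mono G K⊆V f∈E[K]) f∉H) , inj₁ (proj₁ (∈E[]⇔ G .to f∈E[K])))

  components-count : NoBalancedComponent G B → ∀ {Ks} → Unique Ks → All Component Ks → length Ks ≤ cost G H
  components-count unbalanced unique components =
    ≤-trans (length≤∣p∣ TouchingComponent touching-components-injective costEdges unique (All.map witness components))
            (∣p∪q∣≤∣p∣+∣q∣ (δ G (V H)) (E[_] G (V H) ─ E H))
    where
    TouchingComponent : VSet G → Edge G → Set
    TouchingComponent K e = Component K × Touches K e
    touching-components-injective : ∀ {K₁ K₂ e} → TouchingComponent K₁ e → TouchingComponent K₂ e → K₁ ≡ K₂
    touching-components-injective (c₁ , t₁) (c₂ , t₂) = touching-components-equal c₁ c₂ t₁ t₂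
    witness : ∀ {K} → Component K → ∃ λ e → e ∈ costEdges × TouchingComponent K e
    witness K-comp = let (e , e∈ , touches) = component-touches-costEdge unbalanced K-comp in e , e∈ , K-comp , touches

  restriction-cleans : ∀ K → Cleaning G B K (E[_] G K ─ E H)
  restriction-cleans K = p─q⊆p _ _ , BalancedE-mono G (p─[p─q]⊆q (E[_] G K) (E H)) H-balanced

  module _ (X : VSet G) (F : ESet G) where

    graftEdges : ESet G
    graftEdges = (E H ∩ E[_] G (∁ X)) ∪ (E[_] G X ─ F)

    graftEdges⁻ : ∀ {f} → f ∈ graftEdges → (f ∈ E H × src G f ∉ X × tgt G f ∉ X) ⊎ (f ∈ E[_] G X ─ F × src G f ∈ X × tgt G f ∈ X)
    graftEdges⁻ f∈ with x∈p∪q⁻ (E H ∩ E[_] G (∁ X)) (E[_] G X ─ F) f∈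
    ... | inj₁ f∈H∩ = let (f∈H , f∈E[∁X]) = x∈p∩q⁻ (E H) _ f∈H∩
                          (s , t) = ∈E[]⇔ G .to f∈E[∁X]
                      in inj₁ (f∈H , x∈∁p⇒x∉p s , x∈∁p⇒x∉p t)
    ... | inj₂ f∈E─F = let (s , t) = ∈E[]⇔ G .to (p─q⊆p _ F f∈E─F) in inj₂ (f∈E─F , s , t)

    graft : Subgraph G
    graft = sub (V H ∪ X) graftEdges well-formed
      where
      well-formed : graftEdges ⊆ E[_] G (V H ∪ X)
      well-formed f∈ with graftEdges⁻ f∈
      ... | inj₁ (f∈H , _)   = E[]-mono G {V H} (p⊆p∪q X) (wf H f∈H)
      ... | inj₂ (f∈E─F , _) = E[]-mono G {X} (q⊆p∪q (V H) X) (p─q⊆p _ F f∈E─F)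

    inside-edge : ∀ {f} → f ∈ graftEdges → src G f ∈ X → f ∈ E[_] G X ─ F
    inside-edge f∈ s∈X with graftEdges⁻ f∈
    ... | inj₁ (_ , s∉X , _) = ⊥-elim (s∉X s∈X)
    ... | inj₂ (f∈E─F , _)   = f∈E─F

    outside-edge : ∀ {f} → f ∈ graftEdges → src G f ∉ X → f ∈ E H
    outside-edge f∈ s∉X with graftEdges⁻ f∈
    ... | inj₁ (f∈H , _)     = f∈H
    ... | inj₂ (_ , s∈X , _) = ⊥-elim (s∉X s∈X)

    graftEdge-monochromatic : ∀ {f} → f ∈ graftEdges → Monochromatic G (lookup X) f
    graftEdge-monochromatic f∈ with graftEdges⁻ f∈
    ... | inj₁ (_ , s∉X , t∉X) = ∉∉⇒lookup≡ s∉X t∉X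
    ... | inj₂ (_ , s∈X , t∈X) = ∈∈⇒lookup≡ s∈X t∈X

    graft-balanced : Cleaning G B X F → Balanced G B graft
    graft-balanced (_ , F-cleans) C cycle C⊆
      with cycle-monochromatic G (lookup X) cycle (λ f → graftEdge-monochromatic ∘ C⊆)
    ... | true  , inside  = F-cleans C cycle λ {f} f∈C → inside-edge (C⊆ f∈C) (lookup⇒[]= _ X (inside f f∈C))
    ... | false , outside = H-balanced C cycle λ {f} f∈C → outside-edge (C⊆ f∈C) (lookup≡false⇒∉ (outside f f∈C))

    lookup-graftEdges : ∀ e → lookup graftEdges e ≡
      (lookup (E H) e ∧ (not (lookup X (src G e)) ∧ not (lookup X (tgt G e)))) ∨
      ((lookup X (src G e) ∧ lookup X (tgt G e)) ∧ not (lookup F e))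
    lookup-graftEdges e = trans (lookup-∪ (E H ∩ E[_] G (∁ X)) (E[_] G X ─ F) e) (cong₂ _∨_ outside inside)
      where
      outside : lookup (E H ∩ E[_] G (∁ X)) e ≡ lookup (E H) e ∧ (not (lookup X (src G e)) ∧ not (lookup X (tgt G e)))
      outside = trans (lookup-∩ (E H) (E[_] G (∁ X)) e)
                      (cong (lookup (E H) e ∧_) (trans (lookup-E[] G (∁ X) e) (cong₂ _∧_ (lookup-∁ X _) (lookup-∁ X _))))
      inside : lookup (E[_] G X ─ F) e ≡ (lookup X (src G e) ∧ lookup X (tgt G e)) ∧ not (lookup F e)
      inside = trans (lookup-─ (E[_] G X) F e) (cong (_∧ not (lookup F e)) (lookup-E[] G X e))

    graft-cost : ∀ {K} → Component K → K ⊆ X → cost G graft + costOn G K (E H) ≤ cost G H + (∣ δ G X ∣ + ∣ F ∣)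
    graft-cost {K} K-comp@(K⊆V , _) K⊆X = begin
      cost G graft + costOn G K (E H)
        ≡⟨ cong₂ _+_ (costOn≡∑ G (V H ∪ X) graftEdges) (costOn≡∑ G K (E H)) ⟩
      ∑[ e < m ] edgeCostAt G (V H ∪ X) graftEdges e + ∑[ e < m ] edgeCostAt G K (E H) e
        ≡⟨ sym (∑-distrib-+ (edgeCostAt G (V H ∪ X) graftEdges) (edgeCostAt G K (E H))) ⟩
      ∑[ e < m ] (edgeCostAt G (V H ∪ X) graftEdges e + edgeCostAt G K (E H) e)
        ≤⟨ ∑-mono-≤ uncrossing ⟩
      ∑[ e < m ] (edgeCostAt G (V H) (E H) e + (crossesX e + 𝟙 (lookup F e)))
        ≡⟨ ∑-distrib-+ (edgeCostAt G (V H) (E H)) (λ e → crossesX e + 𝟙 (lookup F e)) ⟩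
      ∑[ e < m ] edgeCostAt G (V H) (E H) e + ∑[ e < m ] (crossesX e + 𝟙 (lookup F e))
        ≡⟨ cong₂ _+_ (sym (costOn≡∑ G (V H) (E H)))
                     (trans (∑-distrib-+ crossesX (𝟙 ∘ lookup F)) (sym (cong₂ _+_ (∣δ∣≡∑ G X) (∣p∣≡∑ F)))) ⟩
      cost G H + (∣ δ G X ∣ + ∣ F ∣) ∎
      where
      open ≤-Reasoning
      m : ℕ
      m = Graph.m G
      crossesX : Edge G → ℕ
      crossesX e = 𝟙 (lookup X (src G e) xor lookup X (tgt G e))
      uncrossing : ∀ e → edgeCostAt G (V H ∪ X) graftEdges e + edgeCostAt G K (E H) e ≤
                         edgeCostAt G (V H) (E H) e + (crossesX e + 𝟙 (lookup F e))
      uncrossing e rewrite lookup-∪ (V H) X (src G e) | lookup-∪ (V H) X (tgt G e) | lookup-graftEdges e =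
        uncrossing-at-edge (lookup K s) (lookup K t) (lookup X s) (lookup X t) (lookup (V H) s) (lookup (V H) t)
                           (lookup (E H) e) (lookup F e)
                           (⊆⇒lookup⇒ K⊆X s) (⊆⇒lookup⇒ K⊆X t) (⊆⇒lookup⇒ K⊆V s) (⊆⇒lookup⇒ K⊆V t)
                           (joined-in-Vᵇ {e = e} K-comp (inj₁ refl)) (joined-in-Vᵇ {e = e} K-comp (inj₂ refl))
        where
        s t : Vertex G
        s = src G e
        t = tgt G e

  component-δ⊆δ : ∀ {K X} → Component K → K ⊆ X → X ⊆ V H → δ G K ⊆ δ G X
  component-δ⊆δ K-comp K⊆X X⊆V e∈δK =
    let (u , w , j , u∈K , w∉K) = ∈δ⁻ G e∈δK
    in ∈δ⁺ G j (K⊆X u∈K) (λ w∈X → w∉K (joined-in-V K-comp j u∈K (X⊆V w∈X)))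

  X─K-uncrossed : ∀ {K X} → Component K → K ⊆ X → X ⊆ V H → δ G X ⊆ δ G K → ∀ e → e ∉ δ G (X ─ K)
  X─K-uncrossed {K} {X} K-comp K⊆X X⊆V δX⊆δK e e∈δ with ∈δ⁻ G e∈δ
  ... | (u , w , j , u∈X─K , w∉X─K) with w ∈? X
  ...   | yes w∈X = x∈p─q⇒x∉q X K u∈X─K (joined-in-V K-comp (Joins-sym G j) w∈K (X⊆V (p─q⊆p X K u∈X─K)))
    where
    w∈K : w ∈ K
    w∈K = decidable-stable (w ∈? K) (λ w∉K → w∉X─K (x∈p∧x∉q⇒x∈p─q w∈X w∉K))
  ...   | no w∉X = ∈δ⇔ G {K} .to (δX⊆δK (∈δ⁺ G j (p─q⊆p X K u∈X─K) w∉X))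
                     (monochromatic⇔ G (lookup K) j .from (∉∉⇒lookup≡ u∉K (w∉X ∘ K⊆X)))
    where
    u∉K : u ∉ K
    u∉K = x∈p─q⇒x∉q X K u∈X─K

  balanced-component-in-X─K : ∀ {K X F} → Component K → K ⊆ X → K ≢ X → X ⊆ V H → Cleaning G B X F →
    δ G X ⊆ δ G K → F ⊆ E[_] G K → ∃ λ C → IsComponentOf G ⊤ ⊤ C × BalancedE G B (E[_] G C)
  balanced-component-in-X─K {K} {X} {F} K-comp K⊆X K≢X X⊆V (_ , F-cleans) δX⊆δK F⊆E[K] with ⊆-or-witness X K
  ... | inj₁ X⊆K = ⊥-elim (K≢X (⊆-antisym K⊆X X⊆K))
  ... | inj₂ (a , a∈X , a∉K) = balanced (component-of G a)
    where
    balanced : (∃ λ C → a ∈ C × IsComponentOf G ⊤ ⊤ C) → ∃ λ C → IsComponentOf G ⊤ ⊤ C × BalancedE G B (E[_] G C)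
    balanced (C , a∈C , C-comp) = C , C-comp , BalancedE-mono G E[C]⊆E[X]─F F-cleans
      where
      C⊆X─K : C ⊆ X ─ K
      C⊆X─K = component-⊆ G C-comp a∈C (λ e _ → ∉δ⇒monochromatic G {X ─ K} (X─K-uncrossed K-comp K⊆X X⊆V δX⊆δK e))
                          (x∈p∧x∉q⇒x∈p─q a∈X a∉K)
      E[C]⊆E[X]─F : E[_] G C ⊆ E[_] G X ─ F
      E[C]⊆E[X]─F f∈E[C] =
        let f∈E[X─K] = E[]-mono G C⊆X─K f∈E[C]
            s∈X─K    = proj₁ (∈E[]⇔ G .to f∈E[X─K])
        in x∈p∧x∉q⇒x∈p─q (E[]-mono G (p─q⊆p X K) f∈E[X─K])
                         (λ f∈F → x∈p─q⇒x∉q X K s∈X─K (proj₁ (∈E[]⇔ G .to (F⊆E[K] f∈F))))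

  component-cheaper-than-superset : NoBalancedComponent G B → ∀ {K X F} → Component K → K ⊆ X → K ≢ X → X ⊆ V H →
    Cleaning G B X F → ∃ λ F′ → Cleaning G B K F′ × ∣ δ G K ∣ + ∣ F′ ∣ < ∣ δ G X ∣ + ∣ F ∣
  component-cheaper-than-superset unbalanced {K} {X} {F} K-comp K⊆X K≢X X⊆V X-cleaning@(_ , F-cleans) =
    F ∩ E[_] G K , (p∩q⊆q F _ , BalancedE-mono G restricted F-cleans) ,
    cheaper (⊆-or-witness (δ G X) (δ G K)) (⊆-or-witness F (E[_] G K))
    where
    δK⊆δX : δ G K ⊆ δ G X
    δK⊆δX = component-δ⊆δ K-comp K⊆X X⊆V
    restricted : E[_] G K ─ (F ∩ E[_] G K) ⊆ E[_] G X ─ F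
    restricted f∈ =
      let f∈E[K] = p─q⊆p _ _ f∈
      in x∈p∧x∉q⇒x∈p─q (E[]-mono G K⊆X f∈E[K]) (λ f∈F → x∈p─q⇒x∉q _ _ f∈ (x∈p∩q⁺ (f∈F , f∈E[K])))
    cheaper : (δ G X ⊆ δ G K ⊎ ∃ λ e → e ∈ δ G X × e ∉ δ G K) → (F ⊆ E[_] G K ⊎ ∃ λ f → f ∈ F × f ∉ E[_] G K) →
              ∣ δ G K ∣ + ∣ F ∩ E[_] G K ∣ < ∣ δ G X ∣ + ∣ F ∣
    cheaper (inj₂ (e , e∈δX , e∉δK)) _ = +-mono-<-≤ (p⊂q⇒∣p∣<∣q∣ (δK⊆δX , e , e∈δX , e∉δK)) (∣p∩q∣≤∣p∣ F _)
    cheaper (inj₁ _) (inj₂ (f , f∈F , f∉E[K])) =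
      +-mono-≤-< (p⊆q⇒∣p∣≤∣q∣ δK⊆δX) (p⊂q⇒∣p∣<∣q∣ (p∩q⊆p F _ , f , f∈F , f∉E[K] ∘ p∩q⊆q F _))
    cheaper (inj₁ δX⊆δK) (inj₁ F⊆E[K]) =
      let (C , C-comp , C-balanced) = balanced-component-in-X─K K-comp K⊆X K≢X X⊆V X-cleaning δX⊆δK F⊆E[K]
      in ⊥-elim (unbalanced C C-comp C-balanced)

  component-important : NoBalancedComponent G B → ∀ {K} → Component K → ImportantSet G B K
  component-important unbalanced {K} K-comp
    (X , K⊆X , cx , cy , ((F , F-cleaning , cx≡) , _) , (_ , cy-minimal) , cx≤cy , strict) =
    H-important (graft X F , graft-balanced X F F-cleaning , p⊆p∪q X , graft-cost≤ , graft-strict strict)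
    where
    exchange : cost G (graft X F) + cy ≤ cost G H + cx
    exchange = ≤-trans (+-monoʳ-≤ (cost G (graft X F)) (cy-minimal _ (restriction-cleans K)))
                       (subst (λ c → cost G (graft X F) + costOn G K (E H) ≤ cost G H + c) (sym cx≡)
                              (graft-cost X F K-comp K⊆X))
    graft-cost≤ : cost G (graft X F) ≤ cost G H
    graft-cost≤ = +-cancelʳ-≤ cy _ _ (≤-trans exchange (+-monoʳ-≤ (cost G H) cx≤cy))
    graft-strict : K ≢ X ⊎ cx < cy → V H ≢ V H ∪ X ⊎ cost G (graft X F) < cost G H
    graft-strict (inj₂ cx<cy) = inj₂ (+-cancelʳ-< cy _ _ (≤-<-trans exchange (+-monoʳ-< (cost G H) cx<cy)))
    graft-strict (inj₁ K≢X) with ⊆-or-witness X (V H)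
    ... | inj₂ (x , x∈X , x∉V) = inj₁ λ V≡ → x∉V (subst (x ∈_) (sym V≡) (q⊆p∪q (V H) X x∈X))
    ... | inj₁ X⊆V with component-cheaper-than-superset unbalanced K-comp K⊆X K≢X X⊆V F-cleaning
    ...   | (F′ , F′-cleaning , cheaper) =
      ⊥-elim (<-irrefl refl (≤-<-trans (cy-minimal F′ F′-cleaning) (<-≤-trans (subst (_ <_) (sym cx≡) cheaper) cx≤cy)))

lemma12 : (G : Graph) (B : ESet G → Set) → ThetaProperty G B →
          (∀ K → IsComponentOf G ⊤ ⊤ K → ¬ BalancedE G B (E[_] G K)) →
          (k : ℕ) (H : Subgraph G) → Balanced G B H → ImportantSub G B H →
          cost G H ≤ k →
          ((Ks : List (VSet G)) → Unique Ks →
            All (IsComponentOf G (V H) (E H)) Ks → length Ks ≤ k)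
          ×
          (∀ K → IsComponentOf G (V H) (E H) K →
            ImportantSet G B K × (∀ v → v ∈ V H → ¬ InNbhd G K v))
lemma12 G B _ unbalanced k H H-balanced H-important cost≤k =
  (λ Ks unique components → ≤-trans (components-count unbalanced unique components) cost≤k) ,
  (λ K K-comp → component-important unbalanced K-comp , no-neighbour K-comp)
  where
  open ImportantSubgraph G B H H-balanced H-important
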